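{- For any integers $1<m<n$, the permutation $B(m,n)$ of $\{1,\dots,n\}$ is cyclic (its cycle decomposition is a single $n$-cycle), and $\Gamma(P(B(m,n)))=(m,1,\dots,1)$ with $n-m$ entries equal to $1$.
   Context: Permutations are written as sequences $(\sigma_1,\dots,\sigma_n)$ with $\sigma_i$ the image of $i$. For an integer $N\ge1$, $L(N)$ is the decreasing sequence of the elements of $\{1,\dots,N\}\setminus\{\lceil N/2\rceil\}$. $I(\sigma)$ adds $1$ to every entry of $\sigma$, $I^k$ is its $k$-fold iterate, and $\oplus$ is concatenation. For $1<m<n$, $B(m,n)=(2,3,\dots,m-1)\oplus(\lfloor (n+m)/2\rfloor)\oplus I^{m-1}(L(n-m+1))\oplus(1)$ (with $(2,\dots,m-1)$ empty if $m=2$). $P(\sigma)$ is the Robinson--Schensted--Knuth insertion tableau of $\sigma$ (Schensted row insertion of the entries in order), and $\Gamma(P(\sigma))$ its shape (row lengths, nonincreasing). -}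

module Defs where

open import Data.Nat using (ℕ; zero; suc; _+_; _∸_; _≤_; _<_; _≡ᵇ_; _<ᵇ_; _/_)
open import Data.Bool using (Bool; true; false; if_then_else_)
open import Data.List using (List; []; _∷_; _++_; map; length; [_])
open import Data.Maybe using (Maybe; just; nothing)
open import Data.Product using (_×_; _,_)

-- Permutations are lists (σ₁, …, σₙ) of natural numbers (one-line notation).

decTo : ℕ → List ℕ
decTo zero    = []
decTo (suc n) = suc n ∷ decTo n

range : ℕ → ℕ → List ℕ
range a zero    = []
range a (suc k) = a ∷ range (suc a) k

remove : ℕ → List ℕ → List ℕ
remove c []       = []
remove c (x ∷ xs) = if x ≡ᵇ c then remove c xs else x ∷ remove c xs

ceilHalf : ℕ → ℕ
ceilHalf N = (N + 1) / 2

L : ℕ → List ℕ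
L N = remove (ceilHalf N) (decTo N)

Iter : ℕ → List ℕ → List ℕ
Iter k = map (k +_)

B : ℕ → ℕ → List ℕ
B m n = range 2 (m ∸ 2) ++ [ (n + m) / 2 ] ++ Iter (m ∸ 1) (L (n ∸ m + 1)) ++ [ 1 ]

-- one-line list viewed as a function: i ↦ σᵢ (1-indexed; 0 outside range)
apply : List ℕ → ℕ → ℕ
apply []       i             = 0
apply (x ∷ xs) zero          = 0
apply (x ∷ xs) (suc zero)    = x
apply (x ∷ xs) (suc (suc i)) = apply xs (suc i)

iterate : (ℕ → ℕ) → ℕ → ℕ → ℕ
iterate f zero    x = x
iterate f (suc k) x = f (iterate f k x)

rowInsert : ℕ → List ℕ → Maybe ℕ × List ℕ
rowInsert x []       = nothing , [ x ]
rowInsert x (y ∷ ys) with x <ᵇ y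
... | true  = just y , x ∷ ys
... | false with rowInsert x ys
...   | b , ys' = b , y ∷ ys'

Tableau : Set
Tableau = List (List ℕ)

-- insertion of x into a tableau (rows top to bottom)
insertT : ℕ → Tableau → Tableau
insertT x []         = [ [ x ] ]
insertT x (r ∷ rows) with rowInsert x r
... | nothing , r' = r' ∷ rows
... | just y  , r' = r' ∷ insertT y rows

insertAll : List ℕ → Tableau → Tableau
insertAll []       T = T
insertAll (x ∷ xs) T = insertAll xs (insertT x T)

P : List ℕ → Tableau
P σ = insertAll σ []

Γ : Tableau → List ℕ
Γ = map length

module Submission where

-- Write m = p + 2, a = p + 1 and n − m + 1 = (t + 1) + (c + 1) with c ∈ {t, t + 1}, so that
-- h := ⌊(n + m)/2⌋ = a + c + 1. Then B(m, n) is the word (2, …, a, h, n, n − 1, …, h + 1, h − 1, …, a + 1, 1).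
-- As a function it sends i ↦ i + 1 for i ≤ p and a ↦ h, and on the two decreasing blocks it maps the values
-- just below h to values above h and vice versa; so the orbit of 1 is 1, 2, …, a, h, after which it
-- alternates between the two sides of h, moving outward, until it reaches n. Hence B(m, n) is an n-cycle.
-- Under row insertion, 2, …, a, h, n form the first row; each of n − 1, …, h + 1 then bumps the last entry of
-- that row and each of h − 1, …, a + 1 the second-to-last one, and the bumped values, always smaller than
-- those already below, pile up in the first column; finally 1 bumps 2. So the first row keeps length m and
-- the remaining n − m entries form a column.

open import Defs
open import Data.Bool using (true; false)
open import Data.Maybe using (nothing; just)
open import Data.Nat using (ℕ; zero; suc; _+_; _*_; _∸_; _≤_; _<_; _≡ᵇ_; _<ᵇ_; _/_; z≤n; s≤s; z<s)
open import Data.Nat.Properties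
open import Data.Nat.DivMod using (m*n/n≡m; +-distrib-/-∣ʳ)
open import Data.Nat.Divisibility using (divides-refl)
open import Data.Nat.Tactic.RingSolver using (solve-∀)
open import Data.List using (List; []; _∷_; _++_; map; length; [_]; replicate; reverse)
open import Data.List.Properties using (++-assoc; ++-identityʳ; map-++; length-++; reverse-++)
open import Data.List.Relation.Unary.All as All using (All; []; _∷_)
open import Data.List.Relation.Unary.All.Properties using () renaming (++⁺ to All-++⁺)
open import Data.List.Relation.Unary.Linked using (Linked; [-]; _∷_)
open import Data.List.Relation.Binary.Permutation.Propositional
  using (_↭_; prep; ↭-sym; ↭-trans; ↭-reflexive; module PermutationReasoning)
open import Data.List.Relation.Binary.Permutation.Propositional.Properties
  using (++-comm; ++⁺ˡ; ++⁺; shift; ∷↭∷ʳ; ↭-reverse)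
open import Data.Product using (_×_; _,_; ∃; ∃₂; map₂)
open import Data.Sum using (inj₁; inj₂)
open import Function using (_∘_)
open import Relation.Binary using (tri<; tri≈; tri>)
open import Relation.Binary.PropositionalEquality hiding ([_])
open import Relation.Nullary using (yes; no; contradiction)

<ᵇ-true : ∀ {x y} → x < y → (x <ᵇ y) ≡ true
<ᵇ-true {zero}  {suc y} _         = refl
<ᵇ-true {suc x} {suc y} (s≤s x<y) = <ᵇ-true x<y

<ᵇ-false : ∀ {x y} → y ≤ x → (x <ᵇ y) ≡ false
<ᵇ-false {y = zero}      _         = refl
<ᵇ-false {suc x} {suc y} (s≤s y≤x) = <ᵇ-false y≤x

≡ᵇ-refl : ∀ x → (x ≡ᵇ x) ≡ true
≡ᵇ-refl zero    = refl
≡ᵇ-refl (suc x) = ≡ᵇ-refl x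

≡ᵇ-false : ∀ {x y} → x ≢ y → (x ≡ᵇ y) ≡ false
≡ᵇ-false {zero}  {zero}  x≢y = contradiction refl x≢y
≡ᵇ-false {zero}  {suc y} _   = refl
≡ᵇ-false {suc x} {zero}  _   = refl
≡ᵇ-false {suc x} {suc y} x≢y = ≡ᵇ-false (λ x≡y → x≢y (cong suc x≡y))

desc : ℕ → ℕ → List ℕ
desc b zero    = []
desc b (suc j) = suc (j + b) ∷ desc b j

length-range : ∀ a k → length (range a k) ≡ k
length-range a zero    = refl
length-range a (suc k) = cong suc (length-range (suc a) k)

length-desc : ∀ b j → length (desc b j) ≡ j
length-desc b zero    = refl
length-desc b (suc j) = cong suc (length-desc b j)

range-++ : ∀ a i j → range a i ++ range (a + i) j ≡ range a (i + j)
range-++ a zero    j = cong (λ b → range b j) (+-identityʳ a)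
range-++ a (suc i) j = cong (a ∷_) (begin
  range (suc a) i ++ range (a + suc i) j ≡⟨ cong (λ b → range (suc a) i ++ range b j) (+-suc a i) ⟩
  range (suc a) i ++ range (suc a + i) j ≡⟨ range-++ (suc a) i j ⟩
  range (suc a) (i + j)                 ∎)
  where open ≡-Reasoning

range-below : ∀ a k → All (_< a + k) (range a k)
range-below a zero    = []
range-below a (suc k) = m<m+n a z<s ∷ subst (λ b → All (_< b) (range (suc a) k)) (sym (+-suc a k)) (range-below (suc a) k)

range-∷ʳ : ∀ a k → range a (suc k) ≡ range a k ++ [ a + k ]
range-∷ʳ a zero    = cong [_] (sym (+-identityʳ a))
range-∷ʳ a (suc k) = cong (a ∷_) (trans (range-∷ʳ (suc a) k) (cong (λ x → range (suc a) k ++ [ x ]) (sym (+-suc a k))))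

range-∷-++ : ∀ a k ys → range a k ++ a + k ∷ ys ≡ range a (suc k) ++ ys
range-∷-++ a k ys = trans (sym (++-assoc (range a k) [ a + k ] ys)) (cong (_++ ys) (sym (range-∷ʳ a k)))

desc≡reverse-range : ∀ b j → desc b j ≡ reverse (range (suc b) j)
desc≡reverse-range b zero    = refl
desc≡reverse-range b (suc j) = begin
  suc (j + b) ∷ desc b j                     ≡⟨ cong₂ _∷_ (cong suc (+-comm j b)) (desc≡reverse-range b j) ⟩
  suc b + j ∷ reverse (range (suc b) j)       ≡⟨ sym (reverse-++ (range (suc b) j) [ suc b + j ]) ⟩
  reverse (range (suc b) j ++ [ suc b + j ])  ≡⟨ cong reverse (sym (range-∷ʳ (suc b) j)) ⟩
  reverse (range (suc b) (suc j))            ∎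
  where open ≡-Reasoning

desc↭range : ∀ b j → desc b j ↭ range (suc b) j
desc↭range b j = ↭-trans (↭-reflexive (desc≡reverse-range b j)) (↭-reverse (range (suc b) j))

remove-++ : ∀ c xs ys → remove c (xs ++ ys) ≡ remove c xs ++ remove c ys
remove-++ c []       ys = refl
remove-++ c (x ∷ xs) ys with x ≡ᵇ c
... | true  = remove-++ c xs ys
... | false = cong (x ∷_) (remove-++ c xs ys)

remove-absent : ∀ {c xs} → All (_≢ c) xs → remove c xs ≡ xs
remove-absent                  []           = refl
remove-absent {c} {x ∷ xs} (x≢c ∷ xs≢c) rewrite ≡ᵇ-false x≢c = cong (x ∷_) (remove-absent xs≢c)

remove-head : ∀ c xs → remove c (c ∷ xs) ≡ remove c xs
remove-head c xs rewrite ≡ᵇ-refl c = refl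

desc-above : ∀ b j → All (b <_) (desc b j)
desc-above b zero    = []
desc-above b (suc j) = s≤s (m≤n+m b j) ∷ desc-above b j

decTo-below : ∀ n → All (_< suc n) (decTo n)
decTo-below zero    = []
decTo-below (suc n) = ≤-refl ∷ All.map m<n⇒m<1+n (decTo-below n)

decTo-+ : ∀ j b → decTo (j + b) ≡ desc b j ++ decTo b
decTo-+ zero    b = refl
decTo-+ (suc j) b = cong (suc (j + b) ∷_) (decTo-+ j b)

remove-decTo : ∀ j c → remove (suc c) (decTo (j + suc c)) ≡ desc (suc c) j ++ decTo c
remove-decTo j c = begin
  remove (suc c) (decTo (j + suc c))                                 ≡⟨ cong (remove (suc c)) (decTo-+ j (suc c)) ⟩
  remove (suc c) (desc (suc c) j ++ suc c ∷ decTo c)                 ≡⟨ remove-++ (suc c) (desc (suc c) j) _ ⟩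
  remove (suc c) (desc (suc c) j) ++ remove (suc c) (suc c ∷ decTo c) ≡⟨ cong₂ _++_ upper (trans (remove-head (suc c) (decTo c)) lower) ⟩
  desc (suc c) j ++ decTo c                                          ∎
  where
  open ≡-Reasoning
  upper : remove (suc c) (desc (suc c) j) ≡ desc (suc c) j
  upper = remove-absent (All.map >⇒≢ (desc-above (suc c) j))
  lower : remove (suc c) (decTo c) ≡ decTo c
  lower = remove-absent (All.map <⇒≢ (decTo-below c))

map-desc : ∀ a b j → map (a +_) (desc b j) ≡ desc (b + a) j
map-desc a b zero    = refl
map-desc a b (suc j) = cong₂ _∷_ (trans (+-suc a (j + b)) (cong suc (trans (+-comm a (j + b)) (+-assoc j b a)))) (map-desc a b j)

map-decTo : ∀ a c → map (a +_) (decTo c) ≡ desc a c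
map-decTo a zero    = refl
map-decTo a (suc c) = cong₂ _∷_ (trans (+-suc a c) (cong suc (+-comm a c))) (map-decTo a c)

Iter-L : ∀ a j c → ceilHalf (j + suc c) ≡ suc c → Iter a (L (j + suc c)) ≡ desc (suc (c + a)) j ++ desc a c
Iter-L a j c centre = begin
  map (a +_) (remove (ceilHalf (j + suc c)) (decTo (j + suc c))) ≡⟨ cong (λ x → map (a +_) (remove x (decTo (j + suc c)))) centre ⟩
  map (a +_) (remove (suc c) (decTo (j + suc c)))                ≡⟨ cong (map (a +_)) (remove-decTo j c) ⟩
  map (a +_) (desc (suc c) j ++ decTo c)                         ≡⟨ map-++ (a +_) (desc (suc c) j) (decTo c) ⟩
  map (a +_) (desc (suc c) j) ++ map (a +_) (decTo c)            ≡⟨ cong₂ _++_ (map-desc a (suc c) j) (map-decTo a c) ⟩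
  desc (suc (c + a)) j ++ desc a c                               ∎
  where open ≡-Reasoning

apply-++ : ∀ xs ys {k} i → length xs ≡ k → apply (xs ++ ys) (suc (k + i)) ≡ apply ys (suc i)
apply-++ []       ys i refl = refl
apply-++ (x ∷ xs) ys i refl = apply-++ xs ys i refl

apply-range : ∀ a k i ys → i < k → apply (range a k ++ ys) (suc i) ≡ a + i
apply-range a (suc k) zero    ys _         = sym (+-identityʳ a)
apply-range a (suc k) (suc i) ys (s≤s i<k) = trans (apply-range (suc a) k i ys i<k) (sym (+-suc a i))

apply-desc : ∀ b i r ys → apply (desc b (i + suc r) ++ ys) (suc i) ≡ suc (r + b)
apply-desc b zero    r ys = refl
apply-desc b (suc i) r ys = apply-desc b i r ys

Reachable : (ℕ → ℕ) → ℕ → Set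
Reachable f x = ∃ λ k → iterate f k 1 ≡ x

reachable-step : ∀ {f x y} → Reachable f x → f x ≡ y → Reachable f y
reachable-step {f} (k , fᵏ1≡x) fx≡y = suc k , trans (cong f fᵏ1≡x) fx≡y

-- Schensted insertion

Linked-head-< : ∀ {x y ys} → x < y → Linked _<_ (y ∷ ys) → Linked _<_ (x ∷ ys)
Linked-head-< x<y [-]          = [-]
Linked-head-< x<y (y<z ∷ z<zs) = <-trans x<y y<z ∷ z<zs

Linked-range-++ : ∀ {x} a k ys → x < a → Linked _<_ (k + a ∷ ys) → Linked _<_ (x ∷ range a k ++ ys)
Linked-range-++ a zero    ys x<a a<ys = Linked-head-< x<a a<ys
Linked-range-++ a (suc k) ys x<a a<ys = x<a ∷ Linked-range-++ (suc a) k ys ≤-refl (subst (λ b → Linked _<_ (b ∷ ys)) (sym (+-suc k a)) a<ys)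

Linked-range : ∀ {x} a k → x < a → Linked _<_ (x ∷ range a k)
Linked-range {x} a k x<a = subst (λ ys → Linked _<_ (x ∷ ys)) (++-identityʳ (range a k)) (Linked-range-++ a k [] x<a [-])

rowInsert-skip : ∀ {x} us vs → All (_< x) us → rowInsert x (us ++ vs) ≡ map₂ (us ++_) (rowInsert x vs)
rowInsert-skip []       vs []           = refl
rowInsert-skip (u ∷ us) vs (u<x ∷ us<x) rewrite <ᵇ-false (<⇒≤ u<x) | rowInsert-skip us vs us<x = refl

rowInsert-append : ∀ {x} us → All (_< x) us → rowInsert x us ≡ (nothing , us ++ [ x ])
rowInsert-append {x} us us<x = trans (cong (rowInsert x) (sym (++-identityʳ us))) (rowInsert-skip us [] us<x)

rowInsert-bump : ∀ {x y} us vs → All (_< x) us → x < y → rowInsert x (us ++ y ∷ vs) ≡ (just y , us ++ x ∷ vs)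
rowInsert-bump {y = y} us vs us<x x<y rewrite rowInsert-skip us (y ∷ vs) us<x | <ᵇ-true x<y = refl

insertAll-++ : ∀ xs ys T → insertAll (xs ++ ys) T ≡ insertAll ys (insertAll xs T)
insertAll-++ []       ys T = refl
insertAll-++ (x ∷ xs) ys T = insertAll-++ xs ys (insertT x T)

P≡insertAll-[[]] : ∀ xs y ys → P (xs ++ y ∷ ys) ≡ insertAll (xs ++ y ∷ ys) [ [] ]
P≡insertAll-[[]] []       y ys = refl
P≡insertAll-[[]] (x ∷ xs) y ys = refl

insertT-append : ∀ {x} r → All (_< x) r → insertT x [ r ] ≡ [ r ++ [ x ] ]
insertT-append r r<x rewrite rowInsert-append r r<x = refl

insertAll-range : ∀ a k r ys → All (_< a) r → insertAll (range a k ++ ys) [ r ] ≡ insertAll ys [ r ++ range a k ]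
insertAll-range a zero    r ys r<a = cong (λ r′ → insertAll ys [ r′ ]) (sym (++-identityʳ r))
insertAll-range a (suc k) r ys r<a = begin
  insertAll (range (suc a) k ++ ys) (insertT a [ r ])   ≡⟨ cong (insertAll (range (suc a) k ++ ys)) (insertT-append r r<a) ⟩
  insertAll (range (suc a) k ++ ys) [ r ++ [ a ] ]      ≡⟨ insertAll-range (suc a) k (r ++ [ a ]) ys (All-++⁺ (All.map m<n⇒m<1+n r<a) (≤-refl ∷ [])) ⟩
  insertAll ys [ (r ++ [ a ]) ++ range (suc a) k ]      ≡⟨ cong (λ r′ → insertAll ys [ r′ ]) (++-assoc r [ a ] (range (suc a) k)) ⟩
  insertAll ys [ r ++ range a (suc k) ]                 ∎
  where open ≡-Reasoning

column : List ℕ → Tableau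
column = map [_]

Γ-column : ∀ cs → Γ (column cs) ≡ replicate (length cs) 1
Γ-column []       = refl
Γ-column (c ∷ cs) = cong (1 ∷_) (Γ-column cs)

insertT-column : ∀ x cs → Linked _<_ (x ∷ cs) → insertT x (column cs) ≡ column (x ∷ cs)
insertT-column x []       _              = refl
insertT-column x (c ∷ cs) (x<c ∷ sorted) rewrite <ᵇ-true x<c | insertT-column c cs sorted = refl

insertT-bump : ∀ x r cs {y r′} → rowInsert x r ≡ (just y , r′) → Linked _<_ (y ∷ cs) → insertT x (r ∷ column cs) ≡ r′ ∷ column (y ∷ cs)
insertT-bump x r cs {y} bumps sorted rewrite bumps | insertT-column y cs sorted = refl

insertAll-desc : ∀ pre post b j cs → All (_≤ b) pre → Linked _<_ (suc (j + b) ∷ cs) →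
  insertAll (desc b j) ((pre ++ suc (j + b) ∷ post) ∷ column cs) ≡ (pre ++ suc b ∷ post) ∷ column (range (suc (suc b)) j ++ cs)
insertAll-desc pre post b zero    cs pre≤b sorted = refl
insertAll-desc pre post b (suc j) cs pre≤b sorted = begin
  insertAll (desc b j) (insertT (suc (j + b)) ((pre ++ suc (suc (j + b)) ∷ post) ∷ column cs))
    ≡⟨ cong (insertAll (desc b j)) (insertT-bump (suc (j + b)) (pre ++ suc (suc (j + b)) ∷ post) cs (rowInsert-bump pre post pre<x ≤-refl) sorted) ⟩
  insertAll (desc b j) ((pre ++ suc (j + b) ∷ post) ∷ column (suc (suc (j + b)) ∷ cs))
    ≡⟨ insertAll-desc pre post b j _ pre≤b (≤-refl ∷ sorted) ⟩
  (pre ++ suc b ∷ post) ∷ column (range (suc (suc b)) j ++ suc (suc (j + b)) ∷ cs)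
    ≡⟨ cong (λ zs → (pre ++ suc b ∷ post) ∷ column zs) bumped ⟩
  (pre ++ suc b ∷ post) ∷ column (range (suc (suc b)) (suc j) ++ cs) ∎
  where
  open ≡-Reasoning
  pre<x : All (_< suc (j + b)) pre
  pre<x = All.map (λ y≤b → s≤s (≤-trans y≤b (m≤n+m b j))) pre≤b
  bumped : range (suc (suc b)) j ++ suc (suc (j + b)) ∷ cs ≡ range (suc (suc b)) (suc j) ++ cs
  bumped = trans (cong (λ x → range (suc (suc b)) j ++ suc (suc x) ∷ cs) (+-comm j b)) (range-∷-++ (suc (suc b)) j cs)

-- The normal form of B(m, n)

data Balanced (t : ℕ) : ℕ → Set where
  even : Balanced t t
  odd  : Balanced t (suc t)

balanced-split : ∀ q → ∃₂ λ t c → Balanced t c × t + c ≡ q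
balanced-split zero = 0 , 0 , even , refl
balanced-split (suc q) with balanced-split q
... | t , .t       , even , t+t≡q   = t , suc t , odd , trans (+-suc t t) (cong suc t+t≡q)
... | t , .(suc t) , odd  , t+1+t≡q = suc t , suc t , even , cong suc t+1+t≡q

balanced-half : ∀ {t c} → Balanced t c → ∀ x → (suc (t + c) + x * 2) / 2 ≡ c + x
balanced-half {t} even x = begin
  (suc (t + t) + x * 2) / 2 ≡⟨ cong (_/ 2) (rearrange t x) ⟩
  (1 + (t + x) * 2) / 2     ≡⟨ +-distrib-/-∣ʳ 1 {d = 2} (divides-refl (t + x)) ⟩
  (t + x) * 2 / 2           ≡⟨ m*n/n≡m (t + x) 2 ⟩
  t + x                     ∎
  where
  open ≡-Reasoning
  rearrange : ∀ t x → suc (t + t) + x * 2 ≡ 1 + (t + x) * 2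
  rearrange = solve-∀
balanced-half {t} odd x = trans (cong (_/ 2) (rearrange t x)) (m*n/n≡m (suc t + x) 2)
  where
  rearrange : ∀ t x → suc (t + suc t) + x * 2 ≡ (suc t + x) * 2
  rearrange = solve-∀

module Normal (p t c : ℕ) where

  a h n : ℕ
  a = suc p
  h = suc (c + a)
  n = suc (t + h)

  a<h : a < h
  a<h = s≤s (m≤n+m a c)

  h<n : h < n
  h<n = s≤s (m≤n+m h t)

  word : List ℕ
  word = range 2 p ++ h ∷ desc h (suc t) ++ desc a c ++ [ 1 ]

  n∸m : n ∸ suc a ≡ suc (t + c)
  n∸m = trans (cong (_∸ suc a) (rearrange p t c)) (m+n∸m≡n (suc a) (suc (t + c)))
    where
    rearrange : ∀ p t c → suc (t + suc (c + suc p)) ≡ suc (suc p) + suc (t + c)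
    rearrange = solve-∀

  B≡word : Balanced t c → B (suc a) n ≡ word
  B≡word bal = begin
    range 2 p ++ (n + suc a) / 2 ∷ Iter a (L (n ∸ suc a + 1)) ++ [ 1 ]
      ≡⟨ cong₂ (λ x ys → range 2 p ++ x ∷ ys ++ [ 1 ]) midpoint (trans (cong (Iter a ∘ L) width) (Iter-L a (suc t) c centre)) ⟩
    range 2 p ++ h ∷ (desc h (suc t) ++ desc a c) ++ [ 1 ]
      ≡⟨ cong (λ ys → range 2 p ++ h ∷ ys) (++-assoc (desc h (suc t)) (desc a c) [ 1 ]) ⟩
    word ∎
    where
    open ≡-Reasoning
    n+m≡ : ∀ p t c → suc (t + suc (c + suc p)) + suc (suc p) ≡ suc (t + c) + suc (suc p) * 2
    n+m≡ = solve-∀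
    midpoint : (n + suc a) / 2 ≡ h
    midpoint = trans (cong (_/ 2) (n+m≡ p t c)) (trans (balanced-half bal (suc a)) (+-suc c a))
    width : n ∸ suc a + 1 ≡ suc t + suc c
    width = trans (cong (_+ 1) n∸m) (cong suc (trans (+-assoc t c 1) (cong (t +_) (+-comm c 1))))
    N+1≡ : ∀ t c → suc t + suc c + 1 ≡ suc (t + c) + 1 * 2
    N+1≡ = solve-∀
    centre : ceilHalf (suc t + suc c) ≡ suc c
    centre = trans (cong (_/ 2) (N+1≡ t c)) (trans (balanced-half bal 1) (+-comm c 1))

  ranges-++ : range 2 p ++ range (suc a) c ++ range h (suc (suc t)) ≡ range 2 (t + h)
  ranges-++ = begin
    range 2 p ++ range (suc a) c ++ range h (suc (suc t))         ≡⟨ cong (λ x → range 2 p ++ range (suc a) c ++ range (suc x) (suc (suc t))) (+-comm c a) ⟩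
    range 2 p ++ range (suc a) c ++ range (suc a + c) (suc (suc t)) ≡⟨ cong (range 2 p ++_) (range-++ (suc a) c (suc (suc t))) ⟩
    range 2 p ++ range (2 + p) (c + suc (suc t))                  ≡⟨ range-++ 2 p (c + suc (suc t)) ⟩
    range 2 (p + (c + suc (suc t)))                               ≡⟨ cong (range 2) (count p t c) ⟩
    range 2 (t + h)                                               ∎
    where
    open ≡-Reasoning
    count : ∀ p t c → p + (c + suc (suc t)) ≡ t + suc (c + suc p)
    count = solve-∀

  word↭range : word ↭ range 1 n
  word↭range = begin
    range 2 p ++ h ∷ U ++ D ++ [ 1 ]    ≡⟨ cong (λ ys → range 2 p ++ h ∷ ys) (sym (++-assoc U D [ 1 ])) ⟩
    range 2 p ++ (h ∷ U ++ D) ++ [ 1 ]  ↭⟨ ++⁺ˡ (range 2 p) (↭-sym (∷↭∷ʳ 1 (h ∷ U ++ D))) ⟩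
    range 2 p ++ 1 ∷ h ∷ U ++ D         ↭⟨ shift 1 (range 2 p) (h ∷ U ++ D) ⟩
    1 ∷ range 2 p ++ h ∷ U ++ D         ↭⟨ prep 1 (++⁺ˡ (range 2 p) (++-comm (h ∷ U) D)) ⟩
    1 ∷ range 2 p ++ D ++ h ∷ U         ↭⟨ prep 1 (++⁺ˡ (range 2 p) (++⁺ (desc↭range a c) (prep h (desc↭range h (suc t))))) ⟩
    1 ∷ range 2 p ++ range (suc a) c ++ range h (suc (suc t)) ≡⟨ cong (1 ∷_) ranges-++ ⟩
    range 1 n                           ∎
    where
    open PermutationReasoning
    U D : List ℕ
    U = desc h (suc t)
    D = desc a c

  σ : ℕ → ℕ
  σ = apply word

  up down : ℕ → ℕ
  up j   = suc (j + h)
  down r = suc (r + a)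

  σ-prefix : ∀ i → i < p → σ (suc i) ≡ suc (suc i)
  σ-prefix i i<p = apply-range 2 p i _ i<p

  σ-a : σ a ≡ h
  σ-a = trans (cong (λ k → σ (suc k)) (sym (+-identityʳ p))) (apply-++ (range 2 p) _ 0 (length-range 2 p))

  σ-past-h : ∀ i → σ (suc (p + suc i)) ≡ apply (desc h (suc t) ++ desc a c ++ [ 1 ]) (suc i)
  σ-past-h i = apply-++ (range 2 p) _ (suc i) (length-range 2 p)

  σ-down : ∀ r j → r + j ≡ t → σ (down r) ≡ up j
  σ-down r j r+j≡t = begin
    σ (suc (r + suc p))                                        ≡⟨ cong σ (shuffle r p) ⟩
    σ (suc (p + suc r))                                        ≡⟨ σ-past-h r ⟩
    apply (desc h (suc t) ++ desc a c ++ [ 1 ]) (suc r)         ≡⟨ cong (λ k → apply (desc h k ++ desc a c ++ [ 1 ]) (suc r)) (sym r+1+j≡1+t) ⟩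
    apply (desc h (r + suc j) ++ desc a c ++ [ 1 ]) (suc r)     ≡⟨ apply-desc h r j _ ⟩
    up j                                                       ∎
    where
    open ≡-Reasoning
    shuffle : ∀ r p → suc (r + suc p) ≡ suc (p + suc r)
    shuffle = solve-∀
    r+1+j≡1+t : r + suc j ≡ suc t
    r+1+j≡1+t = trans (+-suc r j) (cong suc r+j≡t)

  σ-low-block : ∀ i r → i + suc r ≡ c → σ (suc (i + suc (t + a))) ≡ down r
  σ-low-block i r i+1+r≡c = begin
    σ (suc (i + suc (t + suc p)))                    ≡⟨ cong σ (shuffle i p t) ⟩
    σ (suc (p + suc (suc t + i)))                    ≡⟨ σ-past-h (suc t + i) ⟩
    apply (desc h (suc t) ++ desc a c ++ [ 1 ]) (suc (suc t + i)) ≡⟨ apply-++ (desc h (suc t)) _ i (length-desc h (suc t)) ⟩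
    apply (desc a c ++ [ 1 ]) (suc i)                ≡⟨ cong (λ k → apply (desc a k ++ [ 1 ]) (suc i)) (sym i+1+r≡c) ⟩
    apply (desc a (i + suc r) ++ [ 1 ]) (suc i)      ≡⟨ apply-desc a i r _ ⟩
    down r                                           ∎
    where
    open ≡-Reasoning
    shuffle : ∀ i p t → suc (i + suc (t + suc p)) ≡ suc (p + suc (suc t + i))
    shuffle = solve-∀

  σ-up : Balanced t c → ∀ j r → j + suc r ≡ t → σ (up j) ≡ down r
  σ-up even j r eq = σ-low-block j r eq
  σ-up odd  j r eq = trans (cong (λ k → σ (suc k)) (+-suc j (suc (t + a)))) (σ-low-block (suc j) r (cong suc eq))

  reachable-prefix : ∀ i → i ≤ p → Reachable σ (suc i)
  reachable-prefix zero    _   = 0 , refl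
  reachable-prefix (suc i) i<p = reachable-step (reachable-prefix i (<⇒≤ i<p)) (σ-prefix i i<p)

  reachable-h : Reachable σ h
  reachable-h = reachable-step (reachable-prefix p ≤-refl) σ-a

  reachable-up₀ : Balanced t c → Reachable σ (up 0)
  reachable-up₀ even = reachable-step reachable-h (σ-down t 0 (+-identityʳ t))
  reachable-up₀ odd  = reachable-step (reachable-step reachable-h (σ-low-block 0 t refl)) (σ-down t 0 (+-identityʳ t))

  reachable-up : Balanced t c → ∀ j → j ≤ t → Reachable σ (up j)
  reachable-up bal zero    _      = reachable-up₀ bal
  reachable-up bal (suc j) 1+j≤t with m≤n⇒∃[o]m+o≡n 1+j≤t
  ... | r , 1+j+r≡t = reachable-step (reachable-step (reachable-up bal j (<⇒≤ 1+j≤t)) (σ-up bal j r j+1+r≡t))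
    (σ-down r (suc j) (trans (+-comm r (suc j)) 1+j+r≡t))
    where
    j+1+r≡t : j + suc r ≡ t
    j+1+r≡t = trans (+-suc j r) 1+j+r≡t

  reachable-down-<t : Balanced t c → ∀ r → r < t → Reachable σ (down r)
  reachable-down-<t bal r r<t with m≤n⇒∃[o]m+o≡n r<t
  ... | j , 1+r+j≡t = reachable-step (reachable-up bal j (subst (j ≤_) j+1+r≡t (m≤m+n j (suc r)))) (σ-up bal j r j+1+r≡t)
    where
    j+1+r≡t : j + suc r ≡ t
    j+1+r≡t = trans (+-comm j (suc r)) 1+r+j≡t

  reachable-down : Balanced t c → ∀ r → r < c → Reachable σ (down r)
  reachable-down even r r<t = reachable-down-<t even r r<t
  reachable-down odd  r (s≤s r≤t) with m≤n⇒m<n∨m≡n r≤t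
  ... | inj₁ r<t  = reachable-down-<t odd r r<t
  ... | inj₂ refl = reachable-step reachable-h (σ-low-block 0 t refl)

  reachable-all : Balanced t c → ∀ x → 1 ≤ x → x ≤ n → Reachable σ x
  reachable-all bal (suc y) _ x≤n with y ≤? p
  ... | yes y≤p = reachable-prefix y y≤p
  ... | no  y≰p with m≤n⇒∃[o]m+o≡n (≰⇒> y≰p)
  ...   | o , refl with <-cmp o c
  ...     | tri< o<c _ _ = subst (Reachable σ) (cong suc (+-comm o a)) (reachable-down bal o o<c)
  ...     | tri≈ _ refl _ = subst (Reachable σ) (cong suc (+-comm o a)) reachable-h
  ...     | tri> _ _ c<o with m≤n⇒∃[o]m+o≡n c<o
  ...       | j , refl = subst (Reachable σ) (sym x≡up) (reachable-up bal j j≤t)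
    where
    shuffle : ∀ p c j → suc (suc p + suc (c + j)) ≡ suc (j + suc (c + suc p))
    shuffle = solve-∀
    x≡up : suc (a + suc (c + j)) ≡ up j
    x≡up = shuffle p c j
    j≤t : j ≤ t
    j≤t = +-cancelʳ-≤ h j t (≤-pred (subst (_≤ n) x≡up x≤n))

  prefix-below : ∀ {x} → a < x → All (_< x) (range 2 p)
  prefix-below a<x = All.map (λ y<1+a → <-≤-trans y<1+a a<x) (range-below 2 p)

  first-row : P word ≡ insertAll (desc h t ++ desc a c ++ [ 1 ]) [ (range 2 p ++ [ h ]) ++ [ n ] ]
  first-row = begin
    P word                                            ≡⟨ P≡insertAll-[[]] (range 2 p) h _ ⟩
    insertAll word [ [] ]                             ≡⟨ insertAll-range 2 p [] _ [] ⟩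
    insertAll rest (insertT n (insertT h [ range 2 p ])) ≡⟨ cong (λ T → insertAll rest (insertT n T)) (insertT-append (range 2 p) (prefix-below a<h)) ⟩
    insertAll rest (insertT n [ range 2 p ++ [ h ] ]) ≡⟨ cong (insertAll rest) (insertT-append (range 2 p ++ [ h ]) (All-++⁺ (prefix-below (<-trans a<h h<n)) (h<n ∷ []))) ⟩
    insertAll rest [ (range 2 p ++ [ h ]) ++ [ n ] ]  ∎
    where
    open ≡-Reasoning
    rest : List ℕ
    rest = desc h t ++ desc a c ++ [ 1 ]

  after-upper : insertAll (desc h t) [ (range 2 p ++ [ h ]) ++ [ n ] ] ≡ (range 2 p ++ h ∷ suc h ∷ []) ∷ column (range (suc (suc h)) t)
  after-upper = trans (insertAll-desc (range 2 p ++ [ h ]) [] h t [] pre≤h [-])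
    (cong₂ (λ r cs → r ∷ column cs) (++-assoc (range 2 p) [ h ] [ suc h ]) (++-identityʳ (range (suc (suc h)) t)))
    where
    pre≤h : All (_≤ h) (range 2 p ++ [ h ])
    pre≤h = All-++⁺ (All.map <⇒≤ (prefix-below a<h)) (≤-refl ∷ [])

  after-lower : insertAll (desc a c) ((range 2 p ++ h ∷ suc h ∷ []) ∷ column (range (suc (suc h)) t))
              ≡ (range 2 p ++ suc a ∷ suc h ∷ []) ∷ column (range (suc (suc a)) c ++ range (suc (suc h)) t)
  after-lower = insertAll-desc (range 2 p) [ suc h ] a c _ (All.map ≤-pred (range-below 2 p))
    (Linked-range (suc (suc h)) t (m<n⇒m<1+n (n<1+n h)))

  final-column : List ℕ
  final-column = 2 ∷ range (suc (suc a)) c ++ range (suc (suc h)) t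

  final-column-sorted : Linked _<_ final-column
  final-column-sorted = Linked-range-++ (suc (suc a)) c _ (s≤s (s≤s (s≤s z≤n)))
    (Linked-range (suc (suc h)) t (s≤s (≤-reflexive (trans (+-suc c (suc a)) (cong suc (+-suc c a))))))

  P-word : P word ≡ (1 ∷ range 3 p ++ [ suc h ]) ∷ column final-column
  P-word = begin
    P word                                                   ≡⟨ first-row ⟩
    insertAll (desc h t ++ desc a c ++ [ 1 ]) first          ≡⟨ insertAll-++ (desc h t) _ first ⟩
    insertAll (desc a c ++ [ 1 ]) (insertAll (desc h t) first) ≡⟨ cong (insertAll (desc a c ++ [ 1 ])) after-upper ⟩
    insertAll (desc a c ++ [ 1 ]) upper                      ≡⟨ insertAll-++ (desc a c) [ 1 ] upper ⟩
    insertT 1 (insertAll (desc a c) upper)                   ≡⟨ cong (insertT 1) after-lower ⟩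
    insertT 1 ((range 2 p ++ suc a ∷ [ suc h ]) ∷ column cs) ≡⟨ cong (λ r → insertT 1 (r ∷ column cs)) (range-∷-++ 2 p [ suc h ]) ⟩
    insertT 1 ((2 ∷ range 3 p ++ [ suc h ]) ∷ column cs)      ≡⟨ insertT-bump 1 (2 ∷ range 3 p ++ [ suc h ]) cs refl final-column-sorted ⟩
    (1 ∷ range 3 p ++ [ suc h ]) ∷ column final-column       ∎
    where
    open ≡-Reasoning
    first upper : Tableau
    first = [ (range 2 p ++ [ h ]) ++ [ n ] ]
    upper = (range 2 p ++ h ∷ suc h ∷ []) ∷ column (range (suc (suc h)) t)
    cs : List ℕ
    cs = range (suc (suc a)) c ++ range (suc (suc h)) t

  shape : Γ (P word) ≡ suc a ∷ replicate (suc (t + c)) 1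
  shape = begin
    Γ (P word)                                                    ≡⟨ cong Γ P-word ⟩
    suc (length (range 3 p ++ [ suc h ])) ∷ Γ (column final-column) ≡⟨ cong₂ _∷_ (cong suc row-length) (Γ-column final-column) ⟩
    suc (suc p) ∷ replicate (suc (length cs)) 1                   ≡⟨ cong (λ k → suc (suc p) ∷ replicate (suc k) 1) column-length ⟩
    suc a ∷ replicate (suc (t + c)) 1                             ∎
    where
    open ≡-Reasoning
    cs : List ℕ
    cs = range (suc (suc a)) c ++ range (suc (suc h)) t
    row-length : length (range 3 p ++ [ suc h ]) ≡ suc p
    row-length = trans (length-++ (range 3 p)) (trans (cong (_+ 1) (length-range 3 p)) (+-comm p 1))
    column-length : length cs ≡ t + c
    column-length = trans (length-++ (range (suc (suc a)) c)) (trans (cong₂ _+_ (length-range _ c) (length-range _ t)) (+-comm c t))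

normal-parameters : ∀ p n → suc (suc p) < n → ∃₂ λ t c → Balanced t c × Normal.n p t c ≡ n
normal-parameters p n m<n with m≤n⇒∃[o]m+o≡n m<n
... | q , 3+p+q≡n with balanced-split q
...   | t , c , bal , t+c≡q = t , c , bal , trans (rearrange p t c) (trans (cong (3 + p +_) t+c≡q) 3+p+q≡n)
  where
  rearrange : ∀ p t c → suc (t + suc (c + suc p)) ≡ 3 + p + (t + c)
  rearrange = solve-∀

lemma3p7 : ∀ (m n : ℕ) → 1 < m → m < n →
    (B m n ↭ range 1 n)
    × (∀ j → 1 ≤ j → j ≤ n → ∃ λ k → iterate (apply (B m n)) k 1 ≡ j)
    × (Γ (P (B m n)) ≡ m ∷ replicate (n ∸ m) 1)
lemma3p7 (suc (suc p)) n (s≤s (s≤s z≤n)) m<n with normal-parameters p n m<n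
... | t , c , bal , refl rewrite Normal.B≡word p t c bal | Normal.n∸m p t c =
  Normal.word↭range p t c , Normal.reachable-all p t c bal , Normal.shape p t c
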